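{- Let $E$ be a set of equations. (1) If $t$ is a $\lambda\mu$-term with $\Gamma\vdash t:A,\Delta$ where $\Delta=\alpha_1:B_1,\dots,\alpha_m:B_m$, then $\Gamma,\neg\Delta\vdash' t^*:A$, where $\neg\Delta=\alpha_1:\neg B_1,\dots,\alpha_m:\neg B_m$. (2) If $t$ is a $\lambda\mu^{++}$-term with $\Gamma\vdash' t:A$, where $\Gamma=x_1:A_1,\dots,x_n:A_n,\alpha_1:\neg B_1,\dots,\alpha_m:\neg B_m$, then $\Gamma_\lambda\vdash t^\circ:A,\Gamma_\mu,\delta:\perp$, where $\Gamma_\lambda=x_1:A_1,\dots,x_n:A_n$ and $\Gamma_\mu=\alpha_1:B_1,\dots,\alpha_m:B_m$. (All typings are with respect to $E$.)
   Context: Types: formulas of second-order predicate logic built from atomic formulas with $\perp$, $\rightarrow$, $\forall x$, $\forall X$; $\neg A=A\rightarrow\perp$. $\approx_E$ is the smallest equivalence relation with $a[\vec x:=\vec t]\approx_E b[\vec x:=\vec t]$ for every equation $a=b$ in $E$. $\lambda\mu$-terms: $t ::= x\mid\lambda x\,t\mid(t\;t)\mid\mu\alpha\,[\beta]t$. For $\Gamma=x_1:A_1,\dots,x_n:A_n$ and $\Delta=\alpha_1:B_1,\dots,\alpha_m:B_m$, $\Gamma\vdash t:A,\Delta$ is generated by: (1) $\Gamma\vdash x_i:A_i,\Delta$; (2) from $\Gamma,x:A\vdash t:B,\Delta$ infer $\Gamma\vdash\lambda x\,t:A\rightarrow B,\Delta$; (3) from $\Gamma_1\vdash u:A\rightarrow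 B,\Delta_1$ and $\Gamma_2\vdash v:A,\Delta_2$ infer $\Gamma_1,\Gamma_2\vdash(u\;v):B,\Delta_1,\Delta_2$; (4) from $\Gamma\vdash t:A,\Delta$ with $x$ not free in $\Gamma,\Delta$ infer $\Gamma\vdash t:\forall x\,A,\Delta$; (5) from $\Gamma\vdash t:\forall x\,A,\Delta$ infer $\Gamma\vdash t:A[x:=a],\Delta$ for any term $a$; (6) from $\Gamma\vdash t:A,\Delta$ with $X$ not free in $\Gamma,\Delta$ infer $\Gamma\vdash t:\forall X\,A,\Delta$; (7) from $\Gamma\vdash t:\forall X\,A,\Delta$ infer $\Gamma\vdash t:A[X:=G],\Delta$ for any formula $G$; (8) from $\Gamma\vdash t:A[x:=a],\Delta$ and $a\approx_E b$ infer $\Gamma\vdash t:A[x:=b],\Delta$; (9) from $\Gamma\vdash t:A,\beta:B,\Delta$ infer $\Gamma\vdash\mu\beta\,[\alpha]t:B,\alpha:A,\Delta$ if $\alpha\neq\beta$, and $\Gamma\vdash\mu\alpha\,[\alpha]t:B,\Delta$ if $\alpha=\beta$. $\lambda\mu^{++}$-terms: $t ::= x\mid\alpha\mid\lambda x\,t\mid\mu\alpha\,t\mid(t\;t)$. For $\Gamma=x_1:A_1,\dots,x_n:A_n,\alpha_1:\neg B_1,\dots,\alpha_m:\neg B_m$, $\Gamma\vdash' t:A$ is generated by: (1) $\Gamma\vdash' x_i:A_i$, $\Gamma\vdash'\alpha_j:\neg B_j$; (2) from $\Gamma,x:A\vdash' u:B$ infer $\Gamma\vdash'\lambda x\,u:A\rightarrow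 B$; (3) from $\Gamma_1\vdash' u:A\rightarrow B$, $\Gamma_2\vdash' v:A$ infer $\Gamma_1,\Gamma_2\vdash'(u\;v):B$; (4)-(8) as rules (4)-(8) above without $\Delta$; (9) from $\Gamma,\alpha:\neg B\vdash' u:\perp$ infer $\Gamma\vdash'\mu\alpha\,u:B$. Translation $^*$: $x^*=x$, $(\lambda x\,t)^*=\lambda x\,t^*$, $(u\;v)^*=(u^*\;v^*)$, $(\mu\alpha\,[\beta]t)^*=\mu\alpha\,(\beta\;t^*)$. Translation $^\circ$ from $\lambda\mu^{++}$-terms to $\lambda\mu$-terms, using a distinguished $\mu$-variable $\delta$ that never occurs in $\lambda\mu^{++}$-terms: $x^\circ=x$; $\alpha^\circ=\lambda x\,\mu\gamma\,[\alpha]x$ ($\gamma\neq\alpha$); $(\lambda x\,t)^\circ=\lambda x\,t^\circ$; $(\mu\alpha\,t)^\circ=\mu\alpha\,[\delta]t^\circ$; $(u\;v)^\circ=(u^\circ\;v^\circ)$. -}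

module Defs where

open import Data.Nat using (ℕ; zero; suc; _≡ᵇ_; _<ᵇ_)
open import Data.Bool using (if_then_else_)
open import Data.List using (List; []; _∷_; length; map; upTo; _++_)
open import Data.List.Membership.Propositional using (_∈_)
open import Data.List.Relation.Binary.Subset.Propositional using (_⊆_)
open import Data.Product using (_×_; _,_; map₂)
open import Data.Unit using (⊤)
open import Relation.Binary.PropositionalEquality using (_≢_)

-- First-order terms (de Bruijn variables, function symbols of any arity)

data Term : Set where
  var : ℕ → Term
  fun : ℕ → List Term → Term

mutual
  tsub : (ℕ → Term) → Term → Term
  tsub σ (var i)    = σ i
  tsub σ (fun f ts) = fun f (tsubs σ ts)

  tsubs : (ℕ → Term) → List Term → List Term
  tsubs σ []       = []
  tsubs σ (t ∷ ts) = tsub σ t ∷ tsubs σ ts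

exts : (ℕ → Term) → ℕ → Term
exts σ zero    = var zero
exts σ (suc i) = tsub (λ j → var (suc j)) (σ i)

upFrom : ℕ → ℕ → Term
upFrom k i = var (if i <ᵇ k then i else suc i)

single : Term → ℕ → Term
single a zero    = a
single a (suc i) = var i

inst : List Term → ℕ → Term
inst []       i       = var i
inst (t ∷ ts) zero    = t
inst (t ∷ ts) (suc i) = inst ts i

params : ℕ → List Term
params k = map var (upTo k)

-- Second-order formulas.
-- atom X ts : second-order variable with de Bruijn index X among the
-- variables of arity (length ts), applied to ts.
-- ∀₁ A : ∀x A (binds first-order index 0).
-- ∀₂ k A : ∀X A with X of arity k (binds index 0 among arity-k variables).

data Formula : Set where
  atom : ℕ → List Term → Formula
  ⊥'   : Formula
  _⇒_  : Formula → Formula → Formula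
  ∀₁   : Formula → Formula
  ∀₂   : ℕ → Formula → Formula

infixr 30 _⇒_

¬' : Formula → Formula
¬' A = A ⇒ ⊥'

fsub : (ℕ → Term) → Formula → Formula
fsub σ (atom X ts) = atom X (tsubs σ ts)
fsub σ ⊥'          = ⊥'
fsub σ (A ⇒ B)     = fsub σ A ⇒ fsub σ B
fsub σ (∀₁ A)      = ∀₁ (fsub (exts σ) A)
fsub σ (∀₂ k A)    = ∀₂ k (fsub σ A)

ext2 : ℕ → (ℕ → ℕ → ℕ) → ℕ → ℕ → ℕ
ext2 k ρ j zero    = if j ≡ᵇ k then zero else ρ j zero
ext2 k ρ j (suc Y) = if j ≡ᵇ k then suc (ρ j Y) else ρ j (suc Y)

sren : (ℕ → ℕ → ℕ) → Formula → Formula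
sren ρ (atom X ts) = atom (ρ (length ts) X) ts
sren ρ ⊥'          = ⊥'
sren ρ (A ⇒ B)     = sren ρ A ⇒ sren ρ B
sren ρ (∀₁ A)      = ∀₁ (sren ρ A)
sren ρ (∀₂ k A)    = ∀₂ k (sren (ext2 k ρ) A)

shift2 : ℕ → Formula → Formula
shift2 k = sren (λ j X → if j ≡ᵇ k then suc X else X)

shift1 : Formula → Formula
shift1 = fsub (λ i → var (suc i))

-- second-order substitution: τ j X is a formula with j parameters
-- (first-order indices 0..j-1) replacing the arity-j variable X
ext2s : ℕ → (ℕ → ℕ → Formula) → ℕ → ℕ → Formula
ext2s k τ j zero    = if j ≡ᵇ k then atom zero (params j) else shift2 k (τ j zero)
ext2s k τ j (suc Y) = if j ≡ᵇ k then shift2 k (τ j Y) else shift2 k (τ j (suc Y))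

ssub : (ℕ → ℕ → Formula) → Formula → Formula
ssub τ (atom X ts) = fsub (inst ts) (τ (length ts) X)
ssub τ ⊥'          = ⊥'
ssub τ (A ⇒ B)     = ssub τ A ⇒ ssub τ B
ssub τ (∀₁ A)      = ∀₁ (ssub (λ j X → fsub (upFrom j) (τ j X)) A)
ssub τ (∀₂ k A)    = ∀₂ k (ssub (ext2s k τ) A)

_[_]₁ : Formula → Term → Formula
A [ a ]₁ = fsub (single a) A

sing2 : ℕ → Formula → ℕ → ℕ → Formula
sing2 k G j zero    = if j ≡ᵇ k then G else atom zero (params j)
sing2 k G j (suc Y) = if j ≡ᵇ k then atom Y (params j) else atom (suc Y) (params j)

_[_≔_]₂ : Formula → ℕ → Formula → Formula
A [ k ≔ G ]₂ = ssub (sing2 k G) A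

data _≈[_]_ : Term → (Term → Term → Set) → Term → Set₁ where
  ≈inst  : ∀ {E a b} → E a b → (σ : ℕ → Term) → tsub σ a ≈[ E ] tsub σ b
  ≈refl  : ∀ {E a} → a ≈[ E ] a
  ≈sym   : ∀ {E a b} → a ≈[ E ] b → b ≈[ E ] a
  ≈trans : ∀ {E a b c} → a ≈[ E ] b → b ≈[ E ] c → a ≈[ E ] c

-- Contexts are lists read as sets: _≋_ is equality as sets.

_≋_ : {A : Set} → List A → List A → Set
xs ≋ ys = (xs ⊆ ys) × (ys ⊆ xs)

Decl : Set
Decl = ℕ × Formula

shiftD1 : List Decl → List Decl
shiftD1 = map (map₂ shift1)

shiftD2 : ℕ → List Decl → List Decl
shiftD2 k = map (map₂ (shift2 k))

-- λμ-terms:  mu α β t  is  μα [β] t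

data LMTerm : Set where
  var : ℕ → LMTerm
  lam : ℕ → LMTerm → LMTerm
  app : LMTerm → LMTerm → LMTerm
  mu  : ℕ → ℕ → LMTerm → LMTerm

data _⊢_∶_,_[_] : List Decl → LMTerm → Formula → List Decl → (Term → Term → Set) → Set₁ where
  ax    : ∀ {E Γ Δ x A} → (x , A) ∈ Γ → Γ ⊢ var x ∶ A , Δ [ E ]
  ⇒I    : ∀ {E Γ Δ x A B t} → ((x , A) ∷ Γ) ⊢ t ∶ B , Δ [ E ] → Γ ⊢ lam x t ∶ A ⇒ B , Δ [ E ]
  ⇒E    : ∀ {E Γ Γ₁ Γ₂ Δ Δ₁ Δ₂ A B u v} →
          Γ₁ ⊢ u ∶ A ⇒ B , Δ₁ [ E ] → Γ₂ ⊢ v ∶ A , Δ₂ [ E ] →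
          Γ ≋ (Γ₁ ++ Γ₂) → Δ ≋ (Δ₁ ++ Δ₂) → Γ ⊢ app u v ∶ B , Δ [ E ]
  ∀₁I   : ∀ {E Γ Δ A t} → shiftD1 Γ ⊢ t ∶ A , shiftD1 Δ [ E ] → Γ ⊢ t ∶ ∀₁ A , Δ [ E ]
  ∀₁E   : ∀ {E Γ Δ A t} → Γ ⊢ t ∶ ∀₁ A , Δ [ E ] → (a : Term) → Γ ⊢ t ∶ A [ a ]₁ , Δ [ E ]
  ∀₂I   : ∀ {E Γ Δ A t} k → shiftD2 k Γ ⊢ t ∶ A , shiftD2 k Δ [ E ] → Γ ⊢ t ∶ ∀₂ k A , Δ [ E ]
  ∀₂E   : ∀ {E Γ Δ A t k} → Γ ⊢ t ∶ ∀₂ k A , Δ [ E ] → (G : Formula) → Γ ⊢ t ∶ A [ k ≔ G ]₂ , Δ [ E ]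
  conv  : ∀ {E Γ Δ A t a b} → Γ ⊢ t ∶ A [ a ]₁ , Δ [ E ] → a ≈[ E ] b → Γ ⊢ t ∶ A [ b ]₁ , Δ [ E ]
  μ≢    : ∀ {E Γ Δ Δ' A B t α β} → α ≢ β →
          Γ ⊢ t ∶ A , ((β , B) ∷ Δ) [ E ] → Δ' ≋ ((α , A) ∷ Δ) → Γ ⊢ mu β α t ∶ B , Δ' [ E ]
  μ≡    : ∀ {E Γ Δ A t α} →
          Γ ⊢ t ∶ A , ((α , A) ∷ Δ) [ E ] → Γ ⊢ mu α α t ∶ A , Δ [ E ]

data PPTerm : Set where
  var  : ℕ → PPTerm
  mvar : ℕ → PPTerm
  lam  : ℕ → PPTerm → PPTerm
  mu   : ℕ → PPTerm → PPTerm
  app  : PPTerm → PPTerm → PPTerm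

-- context entries: lv x A is x : A,  mv α B is α : ¬B
data Entry : Set where
  lv : ℕ → Formula → Entry
  mv : ℕ → Formula → Entry

mapE : (Formula → Formula) → Entry → Entry
mapE f (lv x A) = lv x (f A)
mapE f (mv α B) = mv α (f B)

shiftE1 : List Entry → List Entry
shiftE1 = map (mapE shift1)

shiftE2 : ℕ → List Entry → List Entry
shiftE2 k = map (mapE (shift2 k))

data _⊢'_∶_[_] : List Entry → PPTerm → Formula → (Term → Term → Set) → Set₁ where
  axλ  : ∀ {E Γ x A} → lv x A ∈ Γ → Γ ⊢' var x ∶ A [ E ]
  axμ  : ∀ {E Γ α B} → mv α B ∈ Γ → Γ ⊢' mvar α ∶ ¬' B [ E ]
  ⇒I   : ∀ {E Γ x A B u} → (lv x A ∷ Γ) ⊢' u ∶ B [ E ] → Γ ⊢' lam x u ∶ A ⇒ B [ E ]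
  ⇒E   : ∀ {E Γ Γ₁ Γ₂ A B u v} → Γ₁ ⊢' u ∶ A ⇒ B [ E ] → Γ₂ ⊢' v ∶ A [ E ] →
         Γ ≋ (Γ₁ ++ Γ₂) → Γ ⊢' app u v ∶ B [ E ]
  ∀₁I  : ∀ {E Γ A t} → shiftE1 Γ ⊢' t ∶ A [ E ] → Γ ⊢' t ∶ ∀₁ A [ E ]
  ∀₁E  : ∀ {E Γ A t} → Γ ⊢' t ∶ ∀₁ A [ E ] → (a : Term) → Γ ⊢' t ∶ A [ a ]₁ [ E ]
  ∀₂I  : ∀ {E Γ A t} k → shiftE2 k Γ ⊢' t ∶ A [ E ] → Γ ⊢' t ∶ ∀₂ k A [ E ]
  ∀₂E  : ∀ {E Γ A t k} → Γ ⊢' t ∶ ∀₂ k A [ E ] → (G : Formula) → Γ ⊢' t ∶ A [ k ≔ G ]₂ [ E ]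
  conv : ∀ {E Γ A t a b} → Γ ⊢' t ∶ A [ a ]₁ [ E ] → a ≈[ E ] b → Γ ⊢' t ∶ A [ b ]₁ [ E ]
  μI   : ∀ {E Γ α B u} → (mv α B ∷ Γ) ⊢' u ∶ ⊥' [ E ] → Γ ⊢' mu α u ∶ B [ E ]

_* : LMTerm → PPTerm
var x * = var x
lam x t * = lam x (t *)
app u v * = app (u *) (v *)
mu α β t * = mu α (app (mvar β) (t *))

δ : ℕ
δ = zero

-- α° = λx μγ [α] x with the choices x = 0, γ = suc α (so γ ≠ α, γ ≠ δ)
_° : PPTerm → LMTerm
var x ° = var x
mvar α ° = lam zero (mu (suc α) α (var zero))
lam x t ° = lam x (t °)
mu α t ° = mu α δ (t °)
app u v ° = app (u °) (v °)

δ-free : PPTerm → Set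
δ-free (var x)   = ⊤
δ-free (mvar α)  = α ≢ δ
δ-free (lam x t) = δ-free t
δ-free (mu α t)  = (α ≢ δ) × δ-free t
δ-free (app u v) = δ-free u × δ-free v

δ-freeCtx : List Entry → Set
δ-freeCtx Γ = ∀ {α B} → mv α B ∈ Γ → α ≢ δ

_,¬_ : List Decl → List Decl → List Entry
Γ ,¬ Δ = map (λ { (x , A) → lv x A }) Γ ++ map (λ { (α , B) → mv α B }) Δ

ctxλ : List Entry → List Decl
ctxλ []           = []
ctxλ (lv x A ∷ Γ) = (x , A) ∷ ctxλ Γ
ctxλ (mv α B ∷ Γ) = ctxλ Γ

ctxμ : List Entry → List Decl
ctxμ []           = []
ctxμ (lv x A ∷ Γ) = ctxμ Γ
ctxμ (mv α B ∷ Γ) = (α , B) ∷ ctxμ Γ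

-- Part (1): a λμ-judgement Γ ⊢ t : A, Δ becomes a λμ⁺⁺-judgement once each named
-- conclusion α : B is read as a hypothesis α : ¬B; the naming μβ[α]t then becomes
-- μβ (α t), an application of the negated hypothesis α.
-- Part (2) goes back: a hypothesis α : ¬B becomes the named conclusion α : B, the
-- variable α is η-expanded to λx μγ[α]x, and μα t, whose body has type ⊥, is named
-- by the fresh conclusion δ : ⊥.
-- In both directions every typing rule is sent to the same rule; the only work is
-- the bookkeeping of contexts, which are lists compared as sets.
module Submission where

open import Defs
open import Algebra.Bundles using (CommutativeMonoid)
import Algebra.Properties.CommutativeSemigroup as CommutativeSemigroupProperties
open import Data.List using (List; _∷_; []; _++_; map)
open import Data.List.Properties using (map-++; map-∘)
open import Data.List.Membership.Propositional using (_∈_)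
open import Data.List.Membership.Propositional.Properties using (∈-++⁺ˡ; ∈-++⁺ʳ; ∈-++⁻; ∈-map⁺; ∈-map⁻)
open import Data.List.Relation.Binary.Permutation.Propositional using (_↭_; ↭-sym)
open import Data.List.Relation.Binary.Permutation.Propositional.Properties
  using (shift; ++-commutativeMonoid)
open import Data.List.Relation.Binary.Subset.Propositional using (_⊆_)
open import Data.List.Relation.Binary.Subset.Propositional.Properties
  using (⊆-refl; ⊆-trans; ⊆-reflexive-↭; ++⁺; map⁺; ∷⁺ʳ)
open import Data.List.Relation.Unary.Any using (here; there)
open import Data.Product using (_×_; _,_; map₂)
open import Data.Sum using ([_,_])
open import Function using (id; _∘_)
open import Relation.Binary.PropositionalEquality
  using (_≡_; refl; sym; trans; cong; cong₂; subst; subst₂; module ≡-Reasoning)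

module _ {X : Set} where

  ≋-refl : {xs : List X} → xs ≋ xs
  ≋-refl = id , id

  ≋-reflexive : {xs ys : List X} → xs ≡ ys → xs ≋ ys
  ≋-reflexive refl = ≋-refl

  ≋-trans : {xs ys zs : List X} → xs ≋ ys → ys ≋ zs → xs ≋ zs
  ≋-trans (xs⊆ys , ys⊆xs) (ys⊆zs , zs⊆ys) = ⊆-trans xs⊆ys ys⊆zs , ⊆-trans zs⊆ys ys⊆xs

  ↭⇒≋ : {xs ys : List X} → xs ↭ ys → xs ≋ ys
  ↭⇒≋ p = ⊆-reflexive-↭ p , ⊆-reflexive-↭ (↭-sym p)

  ++⁺-≋ : {ws xs ys zs : List X} → ws ≋ xs → ys ≋ zs → (ws ++ ys) ≋ (xs ++ zs)
  ++⁺-≋ (ws⊆xs , xs⊆ws) (ys⊆zs , zs⊆ys) = ++⁺ ws⊆xs ys⊆zs , ++⁺ xs⊆ws zs⊆ys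

  ⊆⇒≋++ : {xs ys : List X} → ys ⊆ xs → xs ≋ (xs ++ ys)
  ⊆⇒≋++ {xs} ys⊆xs = ∈-++⁺ˡ , λ p → [ id , ys⊆xs ] (∈-++⁻ xs p)

  ∈⇒≋∷ : {x : X} {xs : List X} → x ∈ xs → xs ≋ (x ∷ xs)
  ∈⇒≋∷ x∈xs = there , λ { (here refl) → x∈xs ; (there p) → p }

  ++-interchange : (ws xs ys zs : List X) → ((ws ++ xs) ++ (ys ++ zs)) ≋ ((ws ++ ys) ++ (xs ++ zs))
  ++-interchange ws xs ys zs = ↭⇒≋ (interchange ws xs ys zs)
    where
    open CommutativeSemigroupProperties
      (CommutativeMonoid.commutativeSemigroup (++-commutativeMonoid {A = X}))

  ++-distribʳ-≋ : (xs ys zs : List X) → ((xs ++ ys) ++ zs) ≋ ((xs ++ zs) ++ (ys ++ zs))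
  ++-distribʳ-≋ xs ys zs =
    ≋-trans (++⁺-≋ {ws = xs ++ ys} ≋-refl (⊆⇒≋++ ⊆-refl)) (++-interchange xs ys zs zs)

,¬-mono : ∀ {Γ Γ' Δ Δ'} → Γ ⊆ Γ' → Δ ⊆ Δ' → (Γ ,¬ Δ) ⊆ (Γ' ,¬ Δ')
,¬-mono Γ⊆Γ' Δ⊆Δ' = ++⁺ (map⁺ _ Γ⊆Γ') (map⁺ _ Δ⊆Δ')

,¬-cong : ∀ {Γ Γ' Δ Δ'} → Γ ≋ Γ' → Δ ≋ Δ' → (Γ ,¬ Δ) ≋ (Γ' ,¬ Δ')
,¬-cong (Γ⊆Γ' , Γ'⊆Γ) (Δ⊆Δ' , Δ'⊆Δ) = ,¬-mono Γ⊆Γ' Δ⊆Δ' , ,¬-mono Γ'⊆Γ Δ'⊆Δ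

,¬-++ : ∀ Γ₁ Γ₂ Δ₁ Δ₂ → ((Γ₁ ++ Γ₂) ,¬ (Δ₁ ++ Δ₂)) ≋ ((Γ₁ ,¬ Δ₁) ++ (Γ₂ ,¬ Δ₂))
,¬-++ Γ₁ Γ₂ Δ₁ Δ₂ =
  ≋-trans (≋-reflexive (cong₂ _++_ (map-++ _ Γ₁ Γ₂) (map-++ _ Δ₁ Δ₂)))
          (++-interchange (map _ Γ₁) (map _ Γ₂) (map _ Δ₁) (map _ Δ₂))

,¬-∷ : ∀ {Γ Δ Δ' α B} → Δ ⊆ Δ' → (Γ ,¬ ((α , B) ∷ Δ)) ⊆ (mv α B ∷ (Γ ,¬ Δ'))
,¬-∷ {Γ} {Δ} Δ⊆Δ' =
  ⊆-trans (⊆-reflexive-↭ (shift _ (map _ Γ) (map _ Δ))) (∷⁺ʳ _ (,¬-mono ⊆-refl Δ⊆Δ'))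

,¬-map : ∀ f Γ Δ → map (mapE f) (Γ ,¬ Δ) ≡ (map (map₂ f) Γ ,¬ map (map₂ f) Δ)
,¬-map f Γ Δ =
  trans (map-++ (mapE f) (map _ Γ) (map _ Δ))
        (cong₂ _++_ (trans (sym (map-∘ Γ)) (map-∘ Γ)) (trans (sym (map-∘ Δ)) (map-∘ Δ)))

⊢'-μ-throw : ∀ {E Γ Δ Δ' t α β A B} → Δ ⊆ Δ' → mv α A ∈ (mv β B ∷ (Γ ,¬ Δ')) →
             (Γ ,¬ ((β , B) ∷ Δ)) ⊢' t ∶ A [ E ] →
             (Γ ,¬ Δ') ⊢' mu β (app (mvar α) t) ∶ B [ E ]
⊢'-μ-throw Δ⊆Δ' α∈ ⊢t = μI (⇒E (axμ α∈) ⊢t (⊆⇒≋++ (,¬-∷ Δ⊆Δ')))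

typing-* : ∀ {E Γ Δ t A} → Γ ⊢ t ∶ A , Δ [ E ] → (Γ ,¬ Δ) ⊢' t * ∶ A [ E ]
typing-* (ax x∈Γ) = axλ (∈-++⁺ˡ (∈-map⁺ _ x∈Γ))
typing-* (⇒I ⊢t) = ⇒I (typing-* ⊢t)
typing-* (⇒E {Γ₁ = Γ₁} {Γ₂} {Δ₁ = Δ₁} {Δ₂} ⊢u ⊢v Γ≋ Δ≋) =
  ⇒E (typing-* ⊢u) (typing-* ⊢v) (≋-trans (,¬-cong Γ≋ Δ≋) (,¬-++ Γ₁ Γ₂ Δ₁ Δ₂))
typing-* {Γ = Γ} {Δ} (∀₁I ⊢t) =
  ∀₁I (subst (λ Θ → Θ ⊢' _ ∶ _ [ _ ]) (sym (,¬-map shift1 Γ Δ)) (typing-* ⊢t))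
typing-* (∀₁E ⊢t a) = ∀₁E (typing-* ⊢t) a
typing-* {Γ = Γ} {Δ} (∀₂I k ⊢t) =
  ∀₂I k (subst (λ Θ → Θ ⊢' _ ∶ _ [ _ ]) (sym (,¬-map (shift2 k) Γ Δ)) (typing-* ⊢t))
typing-* (∀₂E ⊢t G) = ∀₂E (typing-* ⊢t) G
typing-* (conv ⊢t a≈b) = conv (typing-* ⊢t) a≈b
typing-* {Γ = Γ} (μ≢ _ ⊢t (_ , Δ'⊇)) =
  ⊢'-μ-throw (λ p → Δ'⊇ (there p)) (there (∈-++⁺ʳ (map _ Γ) (∈-map⁺ _ (Δ'⊇ (here refl)))))
             (typing-* ⊢t)
typing-* (μ≡ ⊢t) = ⊢'-μ-throw ⊆-refl (here refl) (typing-* ⊢t)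

ctxμδ : List Entry → List Decl
ctxμδ Γ = ctxμ Γ ++ ((δ , ⊥') ∷ [])

∈-ctxλ⁺ : ∀ {Γ x A} → lv x A ∈ Γ → (x , A) ∈ ctxλ Γ
∈-ctxλ⁺ {lv y B ∷ Γ} (here refl) = here refl
∈-ctxλ⁺ {lv y B ∷ Γ} (there p)   = there (∈-ctxλ⁺ p)
∈-ctxλ⁺ {mv y B ∷ Γ} (there p)   = ∈-ctxλ⁺ p

∈-ctxλ⁻ : ∀ {Γ x A} → (x , A) ∈ ctxλ Γ → lv x A ∈ Γ
∈-ctxλ⁻ {lv y B ∷ Γ} (here refl) = here refl
∈-ctxλ⁻ {lv y B ∷ Γ} (there p)   = there (∈-ctxλ⁻ p)
∈-ctxλ⁻ {mv y B ∷ Γ} p           = there (∈-ctxλ⁻ p)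

∈-ctxμ⁺ : ∀ {Γ α B} → mv α B ∈ Γ → (α , B) ∈ ctxμ Γ
∈-ctxμ⁺ {mv y B ∷ Γ} (here refl) = here refl
∈-ctxμ⁺ {mv y B ∷ Γ} (there p)   = there (∈-ctxμ⁺ p)
∈-ctxμ⁺ {lv y B ∷ Γ} (there p)   = ∈-ctxμ⁺ p

∈-ctxμ⁻ : ∀ {Γ α B} → (α , B) ∈ ctxμ Γ → mv α B ∈ Γ
∈-ctxμ⁻ {mv y B ∷ Γ} (here refl) = here refl
∈-ctxμ⁻ {mv y B ∷ Γ} (there p)   = there (∈-ctxμ⁻ p)
∈-ctxμ⁻ {lv y B ∷ Γ} p           = there (∈-ctxμ⁻ p)

ctxλ-cong : ∀ {Γ Γ'} → Γ ≋ Γ' → ctxλ Γ ≋ ctxλ Γ'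
ctxλ-cong (Γ⊆Γ' , Γ'⊆Γ) = ∈-ctxλ⁺ ∘ Γ⊆Γ' ∘ ∈-ctxλ⁻ , ∈-ctxλ⁺ ∘ Γ'⊆Γ ∘ ∈-ctxλ⁻

ctxμ-cong : ∀ {Γ Γ'} → Γ ≋ Γ' → ctxμ Γ ≋ ctxμ Γ'
ctxμ-cong (Γ⊆Γ' , Γ'⊆Γ) = ∈-ctxμ⁺ ∘ Γ⊆Γ' ∘ ∈-ctxμ⁻ , ∈-ctxμ⁺ ∘ Γ'⊆Γ ∘ ∈-ctxμ⁻

ctxλ-++ : ∀ Γ₁ Γ₂ → ctxλ (Γ₁ ++ Γ₂) ≡ ctxλ Γ₁ ++ ctxλ Γ₂
ctxλ-++ []             Γ₂ = refl
ctxλ-++ (lv x A ∷ Γ₁) Γ₂ = cong ((x , A) ∷_) (ctxλ-++ Γ₁ Γ₂)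
ctxλ-++ (mv α B ∷ Γ₁) Γ₂ = ctxλ-++ Γ₁ Γ₂

ctxμ-++ : ∀ Γ₁ Γ₂ → ctxμ (Γ₁ ++ Γ₂) ≡ ctxμ Γ₁ ++ ctxμ Γ₂
ctxμ-++ []             Γ₂ = refl
ctxμ-++ (lv x A ∷ Γ₁) Γ₂ = ctxμ-++ Γ₁ Γ₂
ctxμ-++ (mv α B ∷ Γ₁) Γ₂ = cong ((α , B) ∷_) (ctxμ-++ Γ₁ Γ₂)

ctxλ-map : ∀ f Γ → ctxλ (map (mapE f) Γ) ≡ map (map₂ f) (ctxλ Γ)
ctxλ-map f []           = refl
ctxλ-map f (lv x A ∷ Γ) = cong ((x , f A) ∷_) (ctxλ-map f Γ)
ctxλ-map f (mv α B ∷ Γ) = ctxλ-map f Γ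

ctxμ-map : ∀ f Γ → ctxμ (map (mapE f) Γ) ≡ map (map₂ f) (ctxμ Γ)
ctxμ-map f []           = refl
ctxμ-map f (lv x A ∷ Γ) = ctxμ-map f Γ
ctxμ-map f (mv α B ∷ Γ) = cong ((α , f B) ∷_) (ctxμ-map f Γ)

ctxμδ-map : ∀ f → f ⊥' ≡ ⊥' → ∀ Γ → ctxμδ (map (mapE f) Γ) ≡ map (map₂ f) (ctxμδ Γ)
ctxμδ-map f f⊥'≡⊥' Γ = begin
  ctxμ (map (mapE f) Γ) ++ ((δ , ⊥') ∷ [])        ≡⟨ cong₂ (λ Θ C → Θ ++ ((δ , C) ∷ [])) (ctxμ-map f Γ) (sym f⊥'≡⊥') ⟩
  map (map₂ f) (ctxμ Γ) ++ map (map₂ f) ((δ , ⊥') ∷ []) ≡⟨ map-++ (map₂ f) (ctxμ Γ) _ ⟨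
  map (map₂ f) (ctxμδ Γ)                             ∎
  where open ≡-Reasoning

δ∈ctxμδ : ∀ Γ → (δ , ⊥') ∈ ctxμδ Γ
δ∈ctxμδ Γ = ∈-++⁺ʳ (ctxμ Γ) (here refl)

ctxμδ-cong-++ : ∀ {Γ} Γ₁ Γ₂ → Γ ≋ (Γ₁ ++ Γ₂) → ctxμδ Γ ≋ (ctxμδ Γ₁ ++ ctxμδ Γ₂)
ctxμδ-cong-++ Γ₁ Γ₂ Γ≋ =
  ≋-trans (++⁺-≋ (≋-trans (ctxμ-cong Γ≋) (≋-reflexive (ctxμ-++ Γ₁ Γ₂))) ≋-refl)
          (++-distribʳ-≋ (ctxμ Γ₁) (ctxμ Γ₂) _)

δ-freeCtx-map : ∀ f Γ → δ-freeCtx Γ → δ-freeCtx (map (mapE f) Γ)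
δ-freeCtx-map f Γ δ∉Γ p with ∈-map⁻ (mapE f) p
... | mv α B , q , refl = δ∉Γ q

typing-° : ∀ {E Γ t A} → Γ ⊢' t ∶ A [ E ] → δ-free t → δ-freeCtx Γ →
           ctxλ Γ ⊢ t ° ∶ A , ctxμδ Γ [ E ]
typing-° (axλ x∈Γ) _ _ = ax (∈-ctxλ⁺ x∈Γ)
typing-° {Γ = Γ} (axμ α∈Γ) _ _ =
  ⇒I (μ≢ (λ ()) (ax (here refl)) (∈⇒≋∷ (∈-++⁺ˡ (∈-ctxμ⁺ {Γ} α∈Γ))))
typing-° (⇒I ⊢u) δ∉u δ∉Γ = ⇒I (typing-° ⊢u δ∉u λ { (there p) → δ∉Γ p })
typing-° (⇒E {Γ₁ = Γ₁} {Γ₂} ⊢u ⊢v Γ≋@(_ , Γ⊇)) (δ∉u , δ∉v) δ∉Γ =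
  ⇒E (typing-° ⊢u δ∉u (δ∉Γ ∘ Γ⊇ ∘ ∈-++⁺ˡ))
     (typing-° ⊢v δ∉v (δ∉Γ ∘ Γ⊇ ∘ ∈-++⁺ʳ Γ₁))
     (≋-trans (ctxλ-cong Γ≋) (≋-reflexive (ctxλ-++ Γ₁ Γ₂)))
     (ctxμδ-cong-++ Γ₁ Γ₂ Γ≋)
typing-° {Γ = Γ} (∀₁I ⊢t) δ∉t δ∉Γ =
  ∀₁I (subst₂ (λ Θ Δ → Θ ⊢ _ ∶ _ , Δ [ _ ]) (ctxλ-map shift1 Γ) (ctxμδ-map shift1 refl Γ)
              (typing-° ⊢t δ∉t (δ-freeCtx-map shift1 Γ δ∉Γ)))
typing-° (∀₁E ⊢t a) δ∉t δ∉Γ = ∀₁E (typing-° ⊢t δ∉t δ∉Γ) a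
typing-° {Γ = Γ} (∀₂I k ⊢t) δ∉t δ∉Γ =
  ∀₂I k (subst₂ (λ Θ Δ → Θ ⊢ _ ∶ _ , Δ [ _ ]) (ctxλ-map (shift2 k) Γ) (ctxμδ-map (shift2 k) refl Γ)
                (typing-° ⊢t δ∉t (δ-freeCtx-map (shift2 k) Γ δ∉Γ)))
typing-° (∀₂E ⊢t G) δ∉t δ∉Γ = ∀₂E (typing-° ⊢t δ∉t δ∉Γ) G
typing-° (conv ⊢t a≈b) δ∉t δ∉Γ = conv (typing-° ⊢t δ∉t δ∉Γ) a≈b
typing-° {Γ = Γ} (μI ⊢u) (α≢δ , δ∉u) δ∉Γ =
  μ≢ (α≢δ ∘ sym) (typing-° ⊢u δ∉u λ { (here refl) → α≢δ ; (there p) → δ∉Γ p })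
     (∈⇒≋∷ (δ∈ctxμδ Γ))

theorem5 : (E : Term → Term → Set) →
    (∀ {Γ Δ t A} → Γ ⊢ t ∶ A , Δ [ E ] → (Γ ,¬ Δ) ⊢' t * ∶ A [ E ])
    × (∀ {Γ t A} → Γ ⊢' t ∶ A [ E ] → δ-free t → δ-freeCtx Γ →
         ctxλ Γ ⊢ t ° ∶ A , (ctxμ Γ ++ ((δ , ⊥') ∷ [])) [ E ])
theorem5 E = typing-* , typing-°
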